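{- Let $j\ge1$ and $s\ge j$ be integers, write $s=qj+r$ with integers $q\ge 1$ and $0\le r<j$, and let $\alpha=\sum_{i=0}^{q-1}(r+ij+1)$. For $t\in\{s,r\}$ let $g_{j,t,1}$ be the sequence generated by $$g_{j,t,1}(n)=g_{j,t,1}\bigl(n-t-g_{j,t,1}(n-j)\bigr)+j\qquad (n>3+2t+j)$$ with initial conditions $g_{j,t,1}(n)=w_{j,t,1}(n)$ for $1\le n\le 3+2t+j$. Then for every positive integer $n$, $$g_{j,s,1}(n)=g_{j,r,1}(n+\alpha)-qj.$$
   Context: Leaf weight sequence $w_{j,t,1}$ (integers $j\ge1$, $t\ge0$): consider the infinite rooted tree with "supernodes" $S_0,S_1,\dots$, edges $S_i$–$S_{i+1}$, root $S_0$. $S_0$ has two further children, the initial leaf $L_*$ and a leaf $L_0$. For $i\ge1$, $S_i$ has a further child $N_i$ (knot node), below which hangs a single chain (path) of $ij$ nodes whose bottom node is a leaf. Each supernode gets $t$ labels, every other node one label; the labels $1,2,3,\dots$ are assigned consecutively in the order $L_*$, $S_0$, $L_0$, then for $i=1,2,\dots$: $S_i$, $N_i$, the chain below $N_i$ from top to bottom. $L_*$ has weight $1$, every other leaf has weight $j$, and $w_{j,t,1}(n)$ is the total weight of leaves with label $\le n$. -}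

module Defs where

open import Data.Nat using (ℕ; zero; suc; _+_; _*_; _∸_; _≤_; _<_; _≡ᵇ_)
open import Data.Bool using (if_then_else_)
open import Data.List using (List; []; _∷_; map; upTo; concatMap; replicate; take)
open import Data.Nat.ListAction using (sum)
open import Data.Product using (_×_)
open import Relation.Binary.PropositionalEquality using (_≡_)

data Node : Set where
  leafStar : Node
  super    : ℕ → Node
  leaf0    : Node
  knot     : ℕ → Node
  chain    : ℕ → ℕ → Node      -- chain i k : k-th node (1 ≤ k ≤ i*j) of the chain below N_i

oneTo : ℕ → List ℕ
oneTo m = map suc (upTo m)

nodeOrder : (j m : ℕ) → List Node
nodeOrder j m = leafStar ∷ super 0 ∷ leaf0 ∷
  concatMap (λ i → super i ∷ knot i ∷ map (chain i) (oneTo (i * j))) (oneTo m)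

numLabels : (t : ℕ) → Node → ℕ
numLabels t (super _) = t
numLabels t _         = 1

-- weight of a node (0 for non-leaves); the bottom chain node k = i*j is a leaf
nodeWeight : (j : ℕ) → Node → ℕ
nodeWeight j leafStar    = 1
nodeWeight j leaf0       = j
nodeWeight j (chain i k) = if k ≡ᵇ i * j then j else 0
nodeWeight j _           = 0

labelWeights : (j t m : ℕ) → List ℕ
labelWeights j t m = concatMap (λ v → replicate (numLabels t v) (nodeWeight j v)) (nodeOrder j m)

-- w_{j,t,1}(n): total weight of leaves with label ≤ n
-- (n blocks always contain at least n labels, since each block has ≥ 1 label)
w : (j t n : ℕ) → ℕ
w j t n = sum (take n (labelWeights j t n))

α : (q j r : ℕ) → ℕ
α q j r = sum (map (λ i → r + i * j + 1) (upTo q))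

-- g : ℕ → ℕ is "the sequence g_{j,t,1}" on positive indices (g 0 is irrelevant):
-- initial conditions g(n) = w_{j,t,1}(n) for 1 ≤ n ≤ 3+2t+j, and for n > 3+2t+j
-- the recursion is well defined (index n - t - g(n-j) ≥ 1) and holds.
IsG : (j t : ℕ) → (ℕ → ℕ) → Set
IsG j t g =
  (∀ n → 1 ≤ n → n ≤ 3 + 2 * t + j → g n ≡ w j t n) ×
  (∀ n → 3 + 2 * t + j < n →
     (t + g (n ∸ j) < n) × (g n ≡ g (n ∸ t ∸ g (n ∸ j)) + j))

-- The leaf weight w_{j,t,1} is a staircase. Number the leaves 0, 1, 2, ... in label order, L_* being
-- leaf 0; then t + k j labels separate leaf k from leaf k + 1, so leaf k carries label 1 + α k j t, and
-- w_{j,t,1} equals 1 + k j from leaf k up to leaf k + 1. This staircase satisfies the nested recursion,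
-- so by strong induction every g_{j,t,1} equals w_{j,t,1}. For s = q j + r the gaps of the s-staircase
-- are those of the r-staircase with its first q levels, of α q j r labels in total, removed; hence
-- w_{j,s,1}(n) + q j = w_{j,r,1}(n + α).
module Submission where

open import Defs
open import Data.Bool using (if_then_else_)
open import Data.List using (List; []; _∷_; _++_; [_]; map; upTo; applyUpTo; concatMap; replicate; take)
open import Data.List.Properties
  using ( concatMap-++; concatMap-map; concatMap-cong; concatMap-pure
        ; map-upTo; map-++; map-∘; upTo-∷ʳ; ++-assoc)
open import Data.Nat using (ℕ; zero; suc; _+_; _*_; _∸_; _≤_; _<_; _≤?_; _≡ᵇ_; z≤n; s≤s)
open import Data.Nat.Induction using (<-rec)
open import Data.Nat.ListAction using (sum)
open import Data.Nat.ListAction.Properties using (sum-++)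
open import Data.Nat.Properties
open import Data.Nat.Tactic.RingSolver using (solve-∀)
open import Data.Product using (∃₂; _×_; _,_; proj₁; proj₂)
open import Data.Sum using (inj₁; inj₂)
open import Function using (_∘_)
open import Relation.Binary.PropositionalEquality
  using (_≡_; refl; sym; trans; cong; cong₂; subst; module ≡-Reasoning)
open import Relation.Nullary using (yes; no)

open ≡-Reasoning

private
  variable
    A : Set

m≡n+o⇒m∸o≡n : ∀ {m} n o → m ≡ n + o → m ∸ o ≡ n
m≡n+o⇒m∸o≡n n o refl = m+n∸n≡m n o

replicate-+ : ∀ m n (x : A) → replicate (m + n) x ≡ replicate m x ++ replicate n x
replicate-+ zero    n x = refl
replicate-+ (suc m) n x = cong (x ∷_) (replicate-+ m n x)

applyUpTo-onlyLast : ∀ {z x : A} (f : ℕ → A) n →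
  (∀ {i} → i < n → f i ≡ z) → f n ≡ x → applyUpTo f (suc n) ≡ replicate n z ++ [ x ]
applyUpTo-onlyLast f zero    below last = cong [_] last
applyUpTo-onlyLast f (suc n) below last =
  cong₂ _∷_ (below (s≤s z≤n)) (applyUpTo-onlyLast (f ∘ suc) n (λ i<n → below (s≤s i<n)) last)

concatMap-concatMap : ∀ {B C : Set} (f : B → List C) (g : A → List B) xs →
  concatMap f (concatMap g xs) ≡ concatMap (concatMap f ∘ g) xs
concatMap-concatMap f g []       = refl
concatMap-concatMap f g (x ∷ xs) =
  trans (concatMap-++ f (g x) _) (cong (concatMap f (g x) ++_) (concatMap-concatMap f g xs))

map-oneTo : ∀ (f : ℕ → A) n → map f (oneTo n) ≡ applyUpTo (f ∘ suc) n
map-oneTo f n = trans (sym (map-∘ (upTo n))) (map-upTo (f ∘ suc) n)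

if-≡ᵇ-refl : ∀ n {x y : A} → (if n ≡ᵇ n then x else y) ≡ x
if-≡ᵇ-refl zero    = refl
if-≡ᵇ-refl (suc n) = if-≡ᵇ-refl n

if-≡ᵇ-< : ∀ {m n} {x y : A} → m < n → (if m ≡ᵇ n then x else y) ≡ y
if-≡ᵇ-< {m = zero}  {suc n} _         = refl
if-≡ᵇ-< {m = suc m} {suc n} (s≤s m<n) = if-≡ᵇ-< m<n

gapThenLeaf : ℕ → ℕ → List ℕ
gapThenLeaf j n = replicate n 0 ++ [ j ]

sum-take-gapThenLeaf-≤ : ∀ j {d n} xs → d ≤ n → sum (take d (gapThenLeaf j n ++ xs)) ≡ 0
sum-take-gapThenLeaf-≤ j xs z≤n       = refl
sum-take-gapThenLeaf-≤ j xs (s≤s d≤n) = sum-take-gapThenLeaf-≤ j xs d≤n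

sum-take-gapThenLeaf-+ : ∀ j n p xs → sum (take (n + 1 + p) (gapThenLeaf j n ++ xs)) ≡ j + sum (take p xs)
sum-take-gapThenLeaf-+ j zero    p xs = refl
sum-take-gapThenLeaf-+ j (suc n) p xs = sum-take-gapThenLeaf-+ j n p xs

sum-take-staircase : ∀ j (gap : ℕ → ℕ) N k d → k < N → d ≤ gap k →
  sum (take (sum (applyUpTo (λ i → gap i + 1) k) + d) (concatMap (gapThenLeaf j) (applyUpTo gap N)))
    ≡ k * j
sum-take-staircase j gap (suc N) zero    d _         d≤gap = sum-take-gapThenLeaf-≤ j _ d≤gap
sum-take-staircase j gap (suc N) (suc k) d (s≤s k<N) d≤gap = begin
  sum (take (gap 0 + 1 + S + d) (gapThenLeaf j (gap 0) ++ rest))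
    ≡⟨ cong (λ p → sum (take p (gapThenLeaf j (gap 0) ++ rest))) (+-assoc (gap 0 + 1) S d) ⟩
  sum (take (gap 0 + 1 + (S + d)) (gapThenLeaf j (gap 0) ++ rest))
    ≡⟨ sum-take-gapThenLeaf-+ j (gap 0) (S + d) rest ⟩
  j + sum (take (S + d) rest)
    ≡⟨ cong (j +_) (sum-take-staircase j (gap ∘ suc) N k d k<N d≤gap) ⟩
  j + k * j ∎
  where
  S : ℕ
  S = sum (applyUpTo (λ i → gap (suc i) + 1) k)
  rest : List ℕ
  rest = concatMap (gapThenLeaf j) (applyUpTo (gap ∘ suc) N)

-- Leaves are numbered 0, 1, 2, ... in label order: L_*, L_0, then the leaf below N_i is leaf i + 1.
-- Between leaf k and leaf k + 1 lie leafGap t j k labels: those of S_k and, for k ≥ 1, of N_k and of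
-- the k j − 1 chain nodes above leaf k + 1.
leafGap : ℕ → ℕ → ℕ → ℕ
leafGap t j k = t + k * j

-- The d-th label after leaf k; leaf k itself is preceded by the α k j t labels of the levels i < k,
-- each consisting of leaf i and the leafGap t j i labels after it.
label : ℕ → ℕ → ℕ → ℕ → ℕ
label t j k d = suc (α k j t + d)

nodeLabelWeights : ℕ → ℕ → Node → List ℕ
nodeLabelWeights j t v = replicate (numLabels t v) (nodeWeight j v)

chain-weights : ∀ j t i ks →
  concatMap (nodeLabelWeights j t) (map (chain i) ks) ≡ map (λ k → nodeWeight j (chain i k)) ks
chain-weights j t i ks = begin
  concatMap (nodeLabelWeights j t) (map (chain i) ks)     ≡⟨ concatMap-map _ (chain i) ks ⟩
  concatMap ([_] ∘ (λ k → nodeWeight j (chain i k))) ks  ≡⟨ concatMap-map [_] _ ks ⟨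
  concatMap [_] (map (λ k → nodeWeight j (chain i k)) ks) ≡⟨ concatMap-pure _ ⟩
  map (λ k → nodeWeight j (chain i k)) ks                 ∎

block-weights : ∀ j t i → 1 ≤ j →
  concatMap (nodeLabelWeights j t) (super (suc i) ∷ knot (suc i) ∷ map (chain (suc i)) (oneTo (suc i * j)))
    ≡ gapThenLeaf j (leafGap t j (suc i))
block-weights (suc j) t i _ = begin
  replicate t 0 ++ 0 ∷ concatMap (nodeLabelWeights (suc j) t) (map (chain (suc i)) (oneTo (suc L)))
    ≡⟨ cong (λ xs → replicate t 0 ++ 0 ∷ xs) chain-leafOnlyAtBottom ⟩
  replicate t 0 ++ replicate (suc L) 0 ++ [ suc j ]
    ≡⟨ ++-assoc (replicate t 0) (replicate (suc L) 0) [ suc j ] ⟨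
  (replicate t 0 ++ replicate (suc L) 0) ++ [ suc j ]
    ≡⟨ cong (_++ [ suc j ]) (replicate-+ t (suc L) 0) ⟨
  gapThenLeaf (suc j) (t + suc L) ∎
  where
  L : ℕ
  L = j + i * suc j
  chain-leafOnlyAtBottom :
    concatMap (nodeLabelWeights (suc j) t) (map (chain (suc i)) (oneTo (suc L))) ≡ replicate L 0 ++ [ suc j ]
  chain-leafOnlyAtBottom = begin
    concatMap (nodeLabelWeights (suc j) t) (map (chain (suc i)) (oneTo (suc L)))
      ≡⟨ chain-weights (suc j) t (suc i) (oneTo (suc L)) ⟩
    map (λ k → nodeWeight (suc j) (chain (suc i) k)) (oneTo (suc L))
      ≡⟨ map-oneTo _ (suc L) ⟩
    applyUpTo (λ k → nodeWeight (suc j) (chain (suc i) (suc k))) (suc L)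
      ≡⟨ applyUpTo-onlyLast _ L (if-≡ᵇ-< {x = suc j}) (if-≡ᵇ-refl L) ⟩
    replicate L 0 ++ [ suc j ] ∎

labelWeights-staircase : ∀ j t N → 1 ≤ j →
  labelWeights j t N ≡ 1 ∷ concatMap (gapThenLeaf j) (applyUpTo (leafGap t j) (suc N))
labelWeights-staircase j t N j≥1 = cong (1 ∷_) (begin
  replicate t 0 ++ j ∷ concatMap (nodeLabelWeights j t) (concatMap block (oneTo N))
    ≡⟨ cong (λ xs → replicate t 0 ++ j ∷ xs) blocks ⟩
  replicate t 0 ++ j ∷ rest
    ≡⟨ ++-assoc (replicate t 0) [ j ] rest ⟨
  gapThenLeaf j t ++ rest
    ≡⟨ cong (λ n → gapThenLeaf j n ++ rest) (+-identityʳ t) ⟨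
  gapThenLeaf j (leafGap t j 0) ++ rest ∎)
  where
  block : ℕ → List Node
  block i = super i ∷ knot i ∷ map (chain i) (oneTo (i * j))
  rest : List ℕ
  rest = concatMap (gapThenLeaf j) (applyUpTo (leafGap t j ∘ suc) N)
  blocks : concatMap (nodeLabelWeights j t) (concatMap block (oneTo N)) ≡ rest
  blocks = begin
    concatMap (nodeLabelWeights j t) (concatMap block (oneTo N))
      ≡⟨ concatMap-concatMap _ block (oneTo N) ⟩
    concatMap (concatMap (nodeLabelWeights j t) ∘ block) (map suc (upTo N))
      ≡⟨ concatMap-map _ suc (upTo N) ⟩
    concatMap (concatMap (nodeLabelWeights j t) ∘ block ∘ suc) (upTo N)
      ≡⟨ concatMap-cong (λ i → block-weights j t i j≥1) (upTo N) ⟩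
    concatMap (gapThenLeaf j ∘ leafGap t j ∘ suc) (upTo N)
      ≡⟨ concatMap-map (gapThenLeaf j) (leafGap t j ∘ suc) (upTo N) ⟨
    concatMap (gapThenLeaf j) (map (leafGap t j ∘ suc) (upTo N))
      ≡⟨ cong (concatMap (gapThenLeaf j)) (map-upTo _ N) ⟩
    rest ∎

α-leafGaps : ∀ k j t → α k j t ≡ sum (applyUpTo (λ i → leafGap t j i + 1) k)
α-leafGaps k j t = cong sum (map-upTo _ k)

α-suc : ∀ k j t → α (suc k) j t ≡ α k j t + (leafGap t j k + 1)
α-suc k j t = begin
  sum (map f (upTo (suc k)))       ≡⟨ cong (sum ∘ map f) (upTo-∷ʳ k) ⟨
  sum (map f (upTo k ++ [ k ]))    ≡⟨ cong sum (map-++ f (upTo k) [ k ]) ⟩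
  sum (map f (upTo k) ++ [ f k ])  ≡⟨ sum-++ (map f (upTo k)) [ f k ] ⟩
  α k j t + (f k + 0)              ≡⟨ cong (α k j t +_) (+-identityʳ (f k)) ⟩
  α k j t + f k                    ∎
  where
  f : ℕ → ℕ
  f i = leafGap t j i + 1

α-two : ∀ j t → suc (α 2 j t) ≡ 3 + 2 * t + j
α-two j t = unfolded t j
  where
  unfolded : ∀ t j → suc ((t + 0 * j + 1) + ((t + 1 * j + 1) + 0)) ≡ 3 + 2 * t + j
  unfolded = solve-∀

k≤α : ∀ k j t → k ≤ α k j t
k≤α zero    j t = z≤n
k≤α (suc k) j t =
  subst (suc k ≤_) (sym (α-suc k j t))
    (subst (_≤ α k j t + (leafGap t j k + 1)) (+-comm k 1)
      (+-mono-≤ (k≤α k j t) (m≤n+m 1 (leafGap t j k))))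

label-suc : ∀ t j k d → label t j k (suc d) ≡ suc (label t j k d)
label-suc t j k d = cong suc (+-suc (α k j t) d)

label-+ : ∀ t j k d x → label t j k (d + x) ≡ label t j k d + x
label-+ t j k d x = cong suc (sym (+-assoc (α k j t) d x))

label-next : ∀ t j k d → label t j k (leafGap t j k + 1 + d) ≡ label t j (suc k) d
label-next t j k d = cong suc (begin
  α k j t + (leafGap t j k + 1 + d)    ≡⟨ +-assoc (α k j t) _ d ⟨
  α k j t + (leafGap t j k + 1) + d    ≡⟨ cong (_+ d) (α-suc k j t) ⟨
  α (suc k) j t + d                    ∎)

label-down : ∀ t j k d e x → leafGap t j k + 1 + d ≡ e + x → label t j (suc k) d ≡ label t j k e + x
label-down t j k d e x eq =
  trans (sym (label-next t j k d)) (trans (cong (label t j k) eq) (label-+ t j k e x))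

locate : ∀ t j K n → ∃₂ λ k d → K ≤ k × d ≤ leafGap t j k × label t j K n ≡ label t j k d
locate t j K zero = K , 0 , ≤-refl , z≤n , refl
locate t j K (suc n) with locate t j K n
... | k , d , K≤k , d≤gap , eq with m≤n⇒m<n∨m≡n d≤gap
...   | inj₁ d<gap = k , suc d , K≤k , d<gap , (begin
  label t j K (suc n)  ≡⟨ label-suc t j K n ⟩
  suc (label t j K n)  ≡⟨ cong suc eq ⟩
  suc (label t j k d)  ≡⟨ label-suc t j k d ⟨
  label t j k (suc d)  ∎)
...   | inj₂ refl = suc k , 0 , m≤n⇒m≤1+n K≤k , z≤n , (begin
  label t j K (suc n)                    ≡⟨ label-suc t j K n ⟩
  suc (label t j K n)                    ≡⟨ cong suc eq ⟩
  suc (label t j k d)                    ≡⟨ label-suc t j k d ⟨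
  label t j k (suc d)                    ≡⟨ cong (label t j k) (+-comm 1 d) ⟩
  label t j k (d + 1)                    ≡⟨ cong (label t j k) (+-identityʳ (d + 1)) ⟨
  label t j k (leafGap t j k + 1 + 0)    ≡⟨ label-next t j k 0 ⟩
  label t j (suc k) 0                    ∎)

w-level : ∀ {j} t k d → 1 ≤ j → d ≤ leafGap t j k → w j t (label t j k d) ≡ 1 + k * j
w-level {j} t k d j≥1 d≤gap = begin
  w j t m
    ≡⟨ cong (sum ∘ take m) (labelWeights-staircase j t m j≥1) ⟩
  1 + sum (take (α k j t + d) staircase)
    ≡⟨ cong (λ a → 1 + sum (take (a + d) staircase)) (α-leafGaps k j t) ⟩
  1 + sum (take (sum (applyUpTo (λ i → leafGap t j i + 1) k) + d) staircase)
    ≡⟨ cong (1 +_) (sum-take-staircase j (leafGap t j) (suc m) k d k<suc[m] d≤gap) ⟩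
  1 + k * j ∎
  where
  m : ℕ
  m = label t j k d
  staircase : List ℕ
  staircase = concatMap (gapThenLeaf j) (applyUpTo (leafGap t j) (suc m))
  k<suc[m] : k < suc m
  k<suc[m] = s≤s (≤-trans (k≤α k j t) (≤-trans (m≤m+n (α k j t) d) (n≤1+n _)))

leafGap-suc : ∀ t j k → leafGap t j (suc k) ≡ j + leafGap t j k
leafGap-suc t j k =
  trans (sym (+-assoc t j (k * j))) (trans (cong (_+ k * j) (+-comm t j)) (+-assoc j t (k * j)))

w-recursion-descending : ∀ {j} t k d W e → 1 ≤ j →
  d ≤ leafGap t j (2 + k) → e ≤ leafGap t j (suc k) →
  let m = label t j (2 + k) d in
  w j t (m ∸ j) ≡ W → m ≡ label t j (suc k) e + (t + W) →
  w j t m ≡ w j t (m ∸ t ∸ w j t (m ∸ j)) + j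
w-recursion-descending {j} t k d W e j≥1 d≤gap e≤gap w[m∸j] m≡ = begin
  w j t m                           ≡⟨ w-level t (2 + k) d j≥1 d≤gap ⟩
  1 + (2 + k) * j                   ≡⟨ weights k j ⟩
  1 + suc k * j + j                 ≡⟨ cong (_+ j) (w-level t (suc k) e j≥1 e≤gap) ⟨
  w j t (label t j (suc k) e) + j   ≡⟨ cong (λ x → w j t x + j) m∸[t+W]≡ ⟨
  w j t (m ∸ (t + W)) + j           ≡⟨ cong (λ x → w j t x + j) (∸-+-assoc m t W) ⟨
  w j t (m ∸ t ∸ W) + j             ≡⟨ cong (λ x → w j t (m ∸ t ∸ x) + j) w[m∸j] ⟨
  w j t (m ∸ t ∸ w j t (m ∸ j)) + j ∎
  where
  m : ℕ
  m = label t j (2 + k) d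
  m∸[t+W]≡ : m ∸ (t + W) ≡ label t j (suc k) e
  m∸[t+W]≡ = m≡n+o⇒m∸o≡n (label t j (suc k) e) (t + W) m≡
  weights : ∀ k j → 1 + (2 + k) * j ≡ 1 + suc k * j + j
  weights = solve-∀

-- At a label m of level k + 2, m − j lies in level k + 2 or k + 1; in both cases
-- m − t − w(m − j) lands in level k + 1.
w-recursion-level : ∀ {j} t k d → 1 ≤ j → d ≤ leafGap t j (2 + k) →
  let m = label t j (2 + k) d in w j t m ≡ w j t (m ∸ t ∸ w j t (m ∸ j)) + j
w-recursion-level {j} t k d j≥1 d≤gap with j ≤? d
... | no j≰d =
  w-recursion-descending t k d (1 + suc k * j) d j≥1 d≤gap d≤gap′ w[m∸j] m≡
  where
  d<j : d < j
  d<j = ≰⇒> j≰d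
  o : ℕ
  o = t + (k * j + suc d)
  d≤gap′ : d ≤ leafGap t j (suc k)
  d≤gap′ = ≤-trans (<⇒≤ d<j) (≤-trans (m≤m+n j (k * j)) (m≤n+m _ t))
  o≤gap : o ≤ leafGap t j (suc k)
  o≤gap = +-monoʳ-≤ t (subst (k * j + suc d ≤_) (+-comm (k * j) j) (+-monoʳ-≤ (k * j) d<j))
  offsets-∸j : ∀ t j k d → t + suc k * j + 1 + d ≡ t + (k * j + suc d) + j
  offsets-∸j = solve-∀
  offsets : ∀ t j k d → t + suc k * j + 1 + d ≡ d + (t + (1 + suc k * j))
  offsets = solve-∀
  m∸j≡ : label t j (2 + k) d ∸ j ≡ label t j (suc k) o
  m∸j≡ = m≡n+o⇒m∸o≡n _ j (label-down t j (suc k) d o j (offsets-∸j t j k d))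
  w[m∸j] : w j t (label t j (2 + k) d ∸ j) ≡ 1 + suc k * j
  w[m∸j] = trans (cong (w j t) m∸j≡) (w-level t (suc k) o j≥1 o≤gap)
  m≡ : label t j (2 + k) d ≡ label t j (suc k) d + (t + (1 + suc k * j))
  m≡ = label-down t j (suc k) d d _ (offsets t j k d)
... | yes j≤d with m≤n⇒∃[o]m+o≡n j≤d
...   | e , refl =
  w-recursion-descending t k (j + e) (1 + (2 + k) * j) e j≥1 d≤gap e≤gap w[m∸j] m≡
  where
  e≤gap : e ≤ leafGap t j (suc k)
  e≤gap = +-cancelˡ-≤ j e _ (subst (j + e ≤_) (leafGap-suc t j (suc k)) d≤gap)
  m∸j≡ : label t j (2 + k) (j + e) ∸ j ≡ label t j (2 + k) e
  m∸j≡ = m≡n+o⇒m∸o≡n _ j (trans (cong (label t j (2 + k)) (+-comm j e)) (label-+ t j (2 + k) e j))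
  w[m∸j] : w j t (label t j (2 + k) (j + e) ∸ j) ≡ 1 + (2 + k) * j
  w[m∸j] = trans (cong (w j t) m∸j≡) (w-level t (2 + k) e j≥1 (m+n≤o⇒n≤o j d≤gap))
  offsets : ∀ t j k e → t + suc k * j + 1 + (j + e) ≡ e + (t + (1 + (2 + k) * j))
  offsets = solve-∀
  m≡ : label t j (2 + k) (j + e) ≡ label t j (suc k) e + (t + (1 + (2 + k) * j))
  m≡ = label-down t j (suc k) (j + e) e _ (offsets t j k e)

w-recursion : ∀ {j} t m → 1 ≤ j → 3 + 2 * t + j < m → w j t m ≡ w j t (m ∸ t ∸ w j t (m ∸ j)) + j
w-recursion {j} t m j≥1 m>bound with locate t j 2 (m ∸ suc (α 2 j t))
... | suc (suc k) , d , s≤s (s≤s _) , d≤gap , eq =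
  subst (λ m → w j t m ≡ w j t (m ∸ t ∸ w j t (m ∸ j)) + j) (trans (sym eq) m≡label)
    (w-recursion-level t k d j≥1 d≤gap)
  where
  m≡label : label t j 2 (m ∸ suc (α 2 j t)) ≡ m
  m≡label = m+[n∸m]≡n (subst (_≤ m) (sym (α-two j t)) (<⇒≤ m>bound))

w-positive : ∀ j t n → 1 ≤ n → 1 ≤ w j t n
w-positive j t (suc n) _ = s≤s z≤n

IsG⇒≡w : ∀ {j t g} → 1 ≤ j → IsG j t g → ∀ n → 1 ≤ n → g n ≡ w j t n
IsG⇒≡w {j} {t} {g} j≥1 (initial , recursive) = <-rec _ agree
  where
  agree : ∀ n → (∀ {m} → m < n → 1 ≤ m → g m ≡ w j t m) → 1 ≤ n → g n ≡ w j t n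
  agree n ih n≥1 with n ≤? 3 + 2 * t + j
  ... | yes n≤bound = initial n n≥1 n≤bound
  ... | no n≰bound = begin
    g n                           ≡⟨ g-rec ⟩
    g (n ∸ t ∸ g (n ∸ j)) + j     ≡⟨ cong (λ x → g (n ∸ t ∸ x) + j) g≡w[n∸j] ⟩
    g (n ∸ t ∸ W) + j             ≡⟨ cong (_+ j) (ih target<n target≥1) ⟩
    w j t (n ∸ t ∸ W) + j         ≡⟨ w-recursion t n j≥1 n>bound ⟨
    w j t n                       ∎
    where
    n>bound : 3 + 2 * t + j < n
    n>bound = ≰⇒> n≰bound
    j<n : j < n
    j<n = ≤-<-trans (m≤n+m j (3 + 2 * t)) n>bound
    g≡w[n∸j] : g (n ∸ j) ≡ w j t (n ∸ j)
    g≡w[n∸j] = ih (∸-monoʳ-< j≥1 (<⇒≤ j<n)) (m<n⇒0<n∸m j<n)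
    W : ℕ
    W = w j t (n ∸ j)
    g-rec : g n ≡ g (n ∸ t ∸ g (n ∸ j)) + j
    g-rec = proj₂ (recursive n n>bound)
    t+W<n : t + W < n
    t+W<n = subst (λ x → t + x < n) g≡w[n∸j] (proj₁ (recursive n n>bound))
    target≥1 : 1 ≤ n ∸ t ∸ W
    target≥1 = subst (1 ≤_) (sym (∸-+-assoc n t W)) (m<n⇒0<n∸m t+W<n)
    target<n : n ∸ t ∸ W < n
    target<n = subst (_< n) (sym (∸-+-assoc n t W))
      (∸-monoʳ-< (≤-trans (w-positive j t (n ∸ j) (m<n⇒0<n∸m j<n)) (m≤n+m W t)) (<⇒≤ t+W<n))

α-+ : ∀ q k j r → α (q + k) j r ≡ α q j r + α k j (q * j + r)
α-+ q zero    j r = trans (cong (λ n → α n j r) (+-identityʳ q)) (sym (+-identityʳ (α q j r)))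
α-+ q (suc k) j r = begin
  α (q + suc k) j r                                       ≡⟨ cong (λ n → α n j r) (+-suc q k) ⟩
  α (suc (q + k)) j r                                     ≡⟨ α-suc (q + k) j r ⟩
  α (q + k) j r + (leafGap r j (q + k) + 1)               ≡⟨ cong (_+ (leafGap r j (q + k) + 1)) (α-+ q k j r) ⟩
  α q j r + α k j s + (leafGap r j (q + k) + 1)           ≡⟨ regroup (α q j r) (α k j s) r q k j ⟩
  α q j r + (α k j s + (leafGap s j k + 1))               ≡⟨ cong (α q j r +_) (α-suc k j s) ⟨
  α q j r + α (suc k) j s                                 ∎
  where
  s : ℕ
  s = q * j + r
  regroup : ∀ a b r q k j → a + b + (r + (q + k) * j + 1) ≡ a + (b + (q * j + r + k * j + 1))
  regroup = solve-∀

label-shift : ∀ j q r k d → label r j (q + k) d ≡ label (q * j + r) j k d + α q j r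
label-shift j q r k d =
  trans (cong (λ a → suc (a + d)) (α-+ q k j r)) (regroup (α q j r) (α k j (q * j + r)) d)
  where
  regroup : ∀ a b d → suc (a + b + d) ≡ suc (b + d) + a
  regroup = solve-∀

w-shift : ∀ {j} q r n → 1 ≤ j → 1 ≤ n → w j (q * j + r) n + q * j ≡ w j r (n + α q j r)
w-shift {j} q r (suc p) j≥1 _ with locate (q * j + r) j 0 p
... | k , d , _ , d≤gap , eq = begin
  w j s (suc p) + q * j                   ≡⟨ cong (λ n → w j s n + q * j) eq ⟩
  w j s (label s j k d) + q * j           ≡⟨ cong (_+ q * j) (w-level s k d j≥1 d≤gap) ⟩
  1 + k * j + q * j                       ≡⟨ weights q k j ⟩
  1 + (q + k) * j                         ≡⟨ w-level r (q + k) d j≥1 (subst (d ≤_) (gaps q r k j) d≤gap) ⟨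
  w j r (label r j (q + k) d)             ≡⟨ cong (w j r) (label-shift j q r k d) ⟩
  w j r (label s j k d + α q j r)         ≡⟨ cong (λ n → w j r (n + α q j r)) eq ⟨
  w j r (suc p + α q j r)                 ∎
  where
  s : ℕ
  s = q * j + r
  weights : ∀ q k j → 1 + k * j + q * j ≡ 1 + (q + k) * j
  weights = solve-∀
  gaps : ∀ q r k j → q * j + r + k * j ≡ r + (q + k) * j
  gaps = solve-∀

theorem4 : (j s q r : ℕ) → 1 ≤ j → j ≤ s → 1 ≤ q → r < j → s ≡ q * j + r →
    (gs gr : ℕ → ℕ) → IsG j s gs → IsG j r gr →
    ∀ n → 1 ≤ n → gs n + q * j ≡ gr (n + α q j r)
theorem4 j .(q * j + r) q r j≥1 _ _ _ refl gs gr gs-isG gr-isG n n≥1 = begin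
  gs n + q * j               ≡⟨ cong (_+ q * j) (IsG⇒≡w j≥1 gs-isG n n≥1) ⟩
  w j (q * j + r) n + q * j  ≡⟨ w-shift q r n j≥1 n≥1 ⟩
  w j r (n + α q j r)        ≡⟨ IsG⇒≡w j≥1 gr-isG (n + α q j r) (≤-trans n≥1 (m≤m+n n _)) ⟨
  gr (n + α q j r)           ∎
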